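{- Let $q=p^k$ be a prime power with $p\neq 3$, and let $a\in\overline{\mathbb{F}}_q$ be a nontrivial third root of unity. If $A\in S_4(1,-1)\setminus\mathbb{F}_q$, then $aA\notin S_4(1,-1)$ and $a^{ -1}A\notin S_4(1,-1)$.
   Context: $N:\mathbb{F}_{q^3}\to\mathbb{F}_q$ is the norm $N(X)=X^{1+q+q^2}$, and $S_4(1,-1)=\{X\in\mathbb{F}_{q^3}: N(X)=1 \text{ and } N(X+1)=-1\}$. $\overline{\mathbb{F}}_q$ is an algebraic closure of $\mathbb{F}_q$ containing $\mathbb{F}_{q^2}$ and $\mathbb{F}_{q^3}$; a nontrivial third root of unity is a root of $Y^2+Y+1$. -}

module Defs where

open import Level using (Level; _⊔_)
open import Data.Nat using (ℕ; zero; suc)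
open import Data.Fin using (Fin)
open import Data.Vec using (Vec; []; _∷_)
open import Data.Product using (_×_; ∃)
open import Relation.Nullary using (¬_)
open import Algebra.Bundles using (CommutativeRing)

module _ {c ℓ : Level} (R : CommutativeRing c ℓ) where
  open CommutativeRing R

  pow : Carrier → ℕ → Carrier
  pow x zero    = 1#
  pow x (suc n) = x * pow x n

  natCast : ℕ → Carrier
  natCast zero    = 0#
  natCast (suc n) = 1# + natCast n

  IsField : Set (c ⊔ ℓ)
  IsField = (¬ (1# ≈ 0#)) × (∀ x → ¬ (x ≈ 0#) → ∃ λ y → x * y ≈ 1#)

  HasChar : ℕ → Set ℓ
  HasChar p = natCast p ≈ 0#

  evalVec : ∀ {n} → Vec Carrier n → Carrier → Carrier
  evalVec []       x = 0#
  evalVec (a ∷ as) x = a + x * evalVec as x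

  AlgClosed : Set (c ⊔ ℓ)
  AlgClosed = ∀ (n : ℕ) (cs : Vec Carrier (suc n)) →
              ∃ λ x → pow x (suc n) + evalVec cs x ≈ 0#

  -- membership in the subfield F_{q^m} = { x : x^(q^m) = x }
  InF : ℕ → Carrier → Set ℓ
  InF Q x = pow x Q ≈ x

  Norm : ℕ → Carrier → Carrier
  Norm q x = pow x (1 Data.Nat.+ q Data.Nat.+ q Data.Nat.* q)

  S4 : ℕ → Carrier → Set ℓ
  S4 q X = InF (q Data.Nat.* q Data.Nat.* q) X × (Norm q X ≈ 1#) × (Norm q (X + 1#) ≈ - 1#)

-- Suppose aA ∈ S₄(1,-1) as well. The conjugate a^q is again a root of Y² + Y + 1, so it is a or a².
-- If a^q = a², then a^(q³) = a², and aA ∈ F_{q³} gives a²A = aA, impossible since A ≠ 0 and a ≠ a²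
-- (the latter because the characteristic is not 3). If a^q = a, then with B = A^q, C = A^(q²) the
-- three norm conditions N(A) = 1, N(A + 1) = -1, N(aA + 1) = -1 determine the elementary symmetric
-- functions of A, B, C and force (A - a)³ = 0, so A = a ∈ F_q. For a⁻¹, note that it is also a
-- root of Y² + Y + 1.
module Submission where

open import Level using (Level)
open import Algebra.Bundles using (CommutativeRing)
open import Algebra.Solver.Ring.AlmostCommutativeRing
  using (fromCommutativeRing; _-Raw-AlmostCommutative⟶_; Induced-equivalence)
open import Data.Empty using (⊥-elim)
open import Data.Fin as Fin using (Fin; toℕ; inject₁; fromℕ)
import Data.Fin.Properties as Fin
open import Data.Integer as ℤ using (ℤ; +_; -[1+_]; _⊖_)
import Data.Integer.Properties as ℤ
open import Data.Maybe using (map)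
open import Data.Nat as ℕ using (ℕ; zero; suc; _<_; _!; s≤s; z≤n; NonZero)
import Data.Nat.Properties as ℕ
open import Data.Nat.Properties using (_!*_!≢0)
open import Data.Nat.Combinatorics using (_C_; nCn≡1; nCk≡n!/k![n-k]!; k![n∸k]!∣n!)
open import Data.Nat.Coprimality using (Coprime; coprime-Bézout)
open import Data.Nat.Divisibility using (_∣_; divides; ∣1⇒≡1; ∣⇒≤; m∣m*n)
open import Data.Nat.DivMod using (m/n*n≡m)
open import Data.Nat.GCD using (module Bézout)
open import Data.Nat.Primality
  using (Prime; prime?; euclidsLemma; prime⇒irreducible; prime⇒nonZero; ¬prime[0]; ¬prime[1])
open import Data.Product using (_,_; proj₁; proj₂)
open import Data.Sum using (inj₁; inj₂; [_,_]′)
open import Function using (id; _∘_)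
open import Relation.Binary.Consequences using (dec⇒weaklyDec)
open import Relation.Binary.Definitions using (WeaklyDecidable)
open import Relation.Binary.PropositionalEquality as ≡ using (_≡_; _≢_)
open import Relation.Nullary using (¬_)
open import Relation.Nullary.Decidable using (toWitness)

open import Defs

-- Integer coefficients let constant terms normalise without deciding equality in K.
module IntegerCoefficientSolver {c ℓ} (K : CommutativeRing c ℓ) where
  open CommutativeRing K
  open import Algebra.Properties.Ring ring using (-0#≈0#; -‿+-comm; -‿involutive; -‿distribʳ-*)
  open import Algebra.Properties.CommutativeSemigroup +-commutativeSemigroup using (interchange)
  open import Algebra.Properties.Semiring.Mult.TCOptimised semiring using (_×_; ×-homo-+; 1+×)
  open import Relation.Binary.Reasoning.Setoid setoid

  ⟦_⟧ℤ : ℤ → Carrier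
  ⟦ + n ⟧ℤ     = n × 1#
  ⟦ -[1+ n ] ⟧ℤ = - (suc n × 1#)

  ⊖-homo : ∀ m n → ⟦ m ⊖ n ⟧ℤ ≈ m × 1# - n × 1#
  ⊖-homo zero    zero    = sym (-‿inverseʳ 0#)
  ⊖-homo zero    (suc n) = sym (+-identityˡ _)
  ⊖-homo (suc m) zero    = sym (trans (+-congˡ -0#≈0#) (+-identityʳ _))
  ⊖-homo (suc m) (suc n) = begin
    ⟦ suc m ⊖ suc n ⟧ℤ               ≡⟨ ≡.cong ⟦_⟧ℤ (ℤ.[1+m]⊖[1+n]≡m⊖n m n) ⟩
    ⟦ m ⊖ n ⟧ℤ                       ≈⟨ ⊖-homo m n ⟩
    m × 1# - n × 1#                  ≈⟨ +-identityˡ _ ⟨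
    0# + (m × 1# - n × 1#)           ≈⟨ +-congʳ (-‿inverseʳ 1#) ⟨
    (1# - 1#) + (m × 1# - n × 1#)    ≈⟨ interchange _ _ _ _ ⟩
    (1# + m × 1#) + (- 1# - n × 1#)  ≈⟨ +-congˡ (-‿+-comm 1# _) ⟩
    (1# + m × 1#) - (1# + n × 1#)    ≈⟨ +-cong (1+× m 1#) (-‿cong (1+× n 1#)) ⟨
    suc m × 1# - suc n × 1#          ∎

  +-homo : ∀ i j → ⟦ i ℤ.+ j ⟧ℤ ≈ ⟦ i ⟧ℤ + ⟦ j ⟧ℤ
  +-homo (+ m)     (+ n)     = ×-homo-+ 1# m n
  +-homo (+ m)     -[1+ n ]  = ⊖-homo m (suc n)
  +-homo -[1+ m ]  (+ n)     = trans (⊖-homo n (suc m)) (+-comm _ _)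
  +-homo -[1+ m ]  -[1+ n ]  = begin
    - (suc (suc m ℕ.+ n) × 1#)          ≡⟨ ≡.cong (λ k → - (suc k × 1#)) (ℕ.+-suc m n) ⟨
    - ((suc m ℕ.+ suc n) × 1#)          ≈⟨ -‿cong (×-homo-+ 1# (suc m) (suc n)) ⟩
    - (suc m × 1# + suc n × 1#)         ≈⟨ -‿+-comm _ _ ⟨
    - (suc m × 1#) - suc n × 1#         ∎

  -‿homo : ∀ i → ⟦ ℤ.- i ⟧ℤ ≈ - ⟦ i ⟧ℤ
  -‿homo (+ zero)  = sym -0#≈0#
  -‿homo (+ suc n) = refl
  -‿homo -[1+ n ]  = sym (-‿involutive _)

  *-homo-+ : ∀ i n → ⟦ i ℤ.* + n ⟧ℤ ≈ ⟦ i ⟧ℤ * (n × 1#)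
  *-homo-+ i zero    = begin
    ⟦ i ℤ.* + 0 ⟧ℤ  ≡⟨ ≡.cong ⟦_⟧ℤ (ℤ.*-zeroʳ i) ⟩
    0#             ≈⟨ zeroʳ _ ⟨
    ⟦ i ⟧ℤ * 0#     ∎
  *-homo-+ i (suc n) = begin
    ⟦ i ℤ.* + suc n ⟧ℤ            ≡⟨ ≡.cong ⟦_⟧ℤ (ℤ.*-suc i (+ n)) ⟩
    ⟦ i ℤ.+ i ℤ.* + n ⟧ℤ          ≈⟨ +-homo i (i ℤ.* + n) ⟩
    ⟦ i ⟧ℤ + ⟦ i ℤ.* + n ⟧ℤ        ≈⟨ +-cong (sym (*-identityʳ _)) (*-homo-+ i n) ⟩
    ⟦ i ⟧ℤ * 1# + ⟦ i ⟧ℤ * (n × 1#) ≈⟨ distribˡ _ _ _ ⟨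
    ⟦ i ⟧ℤ * (1# + n × 1#)         ≈⟨ *-congˡ (1+× n 1#) ⟨
    ⟦ i ⟧ℤ * (suc n × 1#)          ∎

  *-homo : ∀ i j → ⟦ i ℤ.* j ⟧ℤ ≈ ⟦ i ⟧ℤ * ⟦ j ⟧ℤ
  *-homo i (+ n)     = *-homo-+ i n
  *-homo i -[1+ n ]  = begin
    ⟦ i ℤ.* -[1+ n ] ⟧ℤ           ≡⟨ ≡.cong ⟦_⟧ℤ (ℤ.neg-distribʳ-* i (+ suc n)) ⟨
    ⟦ ℤ.- (i ℤ.* + suc n) ⟧ℤ      ≈⟨ -‿homo (i ℤ.* + suc n) ⟩
    - ⟦ i ℤ.* + suc n ⟧ℤ          ≈⟨ -‿cong (*-homo-+ i (suc n)) ⟩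
    - (⟦ i ⟧ℤ * (suc n × 1#))      ≈⟨ -‿distribʳ-* _ _ ⟩
    ⟦ i ⟧ℤ * - (suc n × 1#)        ∎

  ℤ-morphism : ℤ.+-*-rawRing -Raw-AlmostCommutative⟶ fromCommutativeRing K
  ℤ-morphism = record
    { ⟦_⟧ = ⟦_⟧ℤ ; +-homo = +-homo ; *-homo = *-homo ; -‿homo = -‿homo
    ; 0-homo = refl ; 1-homo = refl }

  ℤ-morphism-≟ : WeaklyDecidable (Induced-equivalence ℤ-morphism)
  ℤ-morphism-≟ i j = map (λ { ≡.refl → refl }) (dec⇒weaklyDec ℤ._≟_ i j)

  open import Algebra.Solver.Ring ℤ.+-*-rawRing (fromCommutativeRing K) ℤ-morphism ℤ-morphism-≟ public


prime∤! : ∀ {p} → Prime p → ∀ n → n < p → ¬ p ∣ n !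
prime∤! p-prime zero    _   p∣1 = ¬prime[1] (≡.subst Prime (∣1⇒≡1 p∣1) p-prime)
prime∤! p-prime (suc n) n<p p∣n! with euclidsLemma (suc n) (n !) p-prime p∣n!
... | inj₁ p∣1+n = ℕ.<⇒≱ n<p (∣⇒≤ p∣1+n)
... | inj₂ p∣n!  = prime∤! p-prime n (ℕ.<-trans (ℕ.n<1+n n) n<p) p∣n!

prime∣C : ∀ {p} → Prime p → ∀ k → 0 < k → k < p → p ∣ p C k
prime∣C {p@(suc p-1)} p-prime k 0<k k<p =
  [ id , ⊥-elim ∘ p∤k![p-k]! ]′ (euclidsLemma (p C k) (k ! ℕ.* (p ℕ.∸ k) !) p-prime p∣C*k![p-k]!)
  where
  k≤p : k ℕ.≤ p
  k≤p = ℕ.<⇒≤ k<p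

  instance
    k![p-k]!≢0 : NonZero (k ! ℕ.* (p ℕ.∸ k) !)
    k![p-k]!≢0 = k !* (p ℕ.∸ k) !≢0

  p∣C*k![p-k]! : p ∣ (p C k) ℕ.* (k ! ℕ.* (p ℕ.∸ k) !)
  p∣C*k![p-k]! = ≡.subst (p ∣_) (≡.sym C*k![p-k]!≡p!) (m∣m*n (p-1 !))
    where
    C*k![p-k]!≡p! : (p C k) ℕ.* (k ! ℕ.* (p ℕ.∸ k) !) ≡ p !
    C*k![p-k]!≡p! = ≡.trans (≡.cong (ℕ._* (k ! ℕ.* (p ℕ.∸ k) !)) (nCk≡n!/k![n-k]! k≤p)) (m/n*n≡m (k![n∸k]!∣n! k≤p))

  p∤k![p-k]! : ¬ p ∣ k ! ℕ.* (p ℕ.∸ k) !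
  p∤k![p-k]! p∣k![p-k]! with euclidsLemma (k !) ((p ℕ.∸ k) !) p-prime p∣k![p-k]!
  ... | inj₁ p∣k!     = prime∤! p-prime k k<p p∣k!
  ... | inj₂ p∣[p-k]! = prime∤! p-prime (p ℕ.∸ k) (ℕ.∸-monoʳ-< 0<k k≤p) p∣[p-k]!

primes-coprime : ∀ {p r} → Prime p → Prime r → p ≢ r → Coprime p r
primes-coprime p-prime r-prime p≢r (d∣p , d∣r) with prime⇒irreducible p-prime d∣p
... | inj₁ d≡1 = d≡1
... | inj₂ ≡.refl with prime⇒irreducible r-prime d∣r
...   | inj₁ ≡.refl = ⊥-elim (¬prime[1] p-prime)
...   | inj₂ p≡r    = ⊥-elim (p≢r p≡r)

module _ {c ℓ} (K : CommutativeRing c ℓ) where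
  open CommutativeRing K
  open import Algebra.Properties.Ring ring using (x≈y⇒x∙y⁻¹≈ε; x∙y⁻¹≈ε⇒x≈y)
  open import Algebra.Properties.Semiring.Exp semiring using (_^_; ^-congˡ; ^-assocʳ; ^-homo-*)
  open import Algebra.Properties.CommutativeSemiring.Exp commutativeSemiring using (^-distrib-*)
  open import Algebra.Properties.Semiring.Mult semiring using (_×_; ×-congʳ; ×1-homo-*; ×-assoc-*)
  open import Algebra.Properties.CommutativeSemiring.Binomial commutativeSemiring using (theorem)
  open import Algebra.Properties.Monoid.Sum +-monoid using (sum; sum-init-last; sum-cong-≋; sum-replicate-zero)
  open import Relation.Binary.Reasoning.Setoid setoid
  open IntegerCoefficientSolver K

  pow≈^ : ∀ x n → pow K x n ≈ x ^ n
  pow≈^ x zero    = refl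
  pow≈^ x (suc n) = *-congˡ (pow≈^ x n)

  1^n≈1 : ∀ n → 1# ^ n ≈ 1#
  1^n≈1 zero    = refl
  1^n≈1 (suc n) = trans (*-identityˡ _) (1^n≈1 n)

  0^n≈0 : ∀ n .{{_ : NonZero n}} → 0# ^ n ≈ 0#
  0^n≈0 (suc n) = zeroˡ _

  ^-compose : ∀ {x y z} m n → x ^ m ≈ y → y ^ n ≈ z → x ^ (m ℕ.* n) ≈ z
  ^-compose {x} m n xᵐ≈y yⁿ≈z = trans (sym (^-assocʳ x m n)) (trans (^-congˡ n xᵐ≈y) yⁿ≈z)

  zero-multiple : ∀ c {h} → h ≈ 0# → c * h ≈ 0#
  zero-multiple c h≈0 = trans (*-congˡ h≈0) (zeroʳ c)

  zero-sum : ∀ {x y} → x ≈ 0# → y ≈ 0# → x + y ≈ 0#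
  zero-sum x≈0 y≈0 = trans (+-cong x≈0 y≈0) (+-identityʳ 0#)

  natCast≈× : ∀ n → natCast K n ≈ n × 1#
  natCast≈× zero    = refl
  natCast≈× (suc n) = +-congˡ (natCast≈× n)

  HasChar-multiple : ∀ {m} x → HasChar K m → HasChar K (x ℕ.* m)
  HasChar-multiple {m} x m≈0 = begin
    natCast K (x ℕ.* m)        ≈⟨ natCast≈× (x ℕ.* m) ⟩
    (x ℕ.* m) × 1#             ≈⟨ ×1-homo-* x m ⟩
    (x × 1#) * (m × 1#)        ≈⟨ *-congˡ (trans (sym (natCast≈× m)) m≈0) ⟩
    (x × 1#) * 0#              ≈⟨ zeroʳ _ ⟩
    0#                         ∎

  HasChar-suc⇒1≈0 : ∀ {s t} → suc s ≡ t → HasChar K s → HasChar K t → 1# ≈ 0#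
  HasChar-suc⇒1≈0 {s} ≡.refl s≈0 1+s≈0 = begin
    1#                 ≈⟨ +-identityʳ 1# ⟨
    1# + 0#            ≈⟨ +-congˡ s≈0 ⟨
    natCast K (suc s)  ≈⟨ 1+s≈0 ⟩
    0#                 ∎

  coprime-HasChar⇒1≈0 : ∀ {m n} → Coprime m n → HasChar K m → HasChar K n → 1# ≈ 0#
  coprime-HasChar⇒1≈0 m⊥n m≈0 n≈0 with coprime-Bézout m⊥n
  ... | Bézout.+- x y 1+yn≡xm =
    HasChar-suc⇒1≈0 1+yn≡xm (HasChar-multiple y n≈0) (HasChar-multiple x m≈0)
  ... | Bézout.-+ x y 1+xm≡yn =
    HasChar-suc⇒1≈0 1+xm≡yn (HasChar-multiple x m≈0) (HasChar-multiple y n≈0)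

  HasChar-∣⇒×≈0 : ∀ {p n} → HasChar K p → p ∣ n → ∀ x → n × x ≈ 0#
  HasChar-∣⇒×≈0 {p} char (divides d ≡.refl) x = begin
    (d ℕ.* p) × x               ≈⟨ ×-congʳ (d ℕ.* p) (*-identityˡ x) ⟨
    (d ℕ.* p) × (1# * x)        ≈⟨ ×-assoc-* (d ℕ.* p) 1# x ⟨
    ((d ℕ.* p) × 1#) * x        ≈⟨ *-congʳ (trans (sym (natCast≈× (d ℕ.* p))) (HasChar-multiple d char)) ⟩
    0# * x                      ≈⟨ zeroˡ x ⟩
    0#                          ∎

  frobenius : ∀ {p} → Prime p → HasChar K p → ∀ x y → (x + y) ^ p ≈ x ^ p + y ^ p
  frobenius {0}                p-prime = ⊥-elim (¬prime[0] p-prime)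
  frobenius {1}                p-prime = ⊥-elim (¬prime[1] p-prime)
  frobenius {p@(suc (suc m))} p-prime char x y = begin
    (x + y) ^ p                                                  ≈⟨ theorem p x y ⟩
    term Fin.zero + sum (λ i → term (Fin.suc i))                 ≈⟨ +-congˡ (sum-init-last (λ i → term (Fin.suc i))) ⟩
    term Fin.zero + (sum inner + term (Fin.suc (fromℕ (suc m)))) ≈⟨ +-cong first (+-cong inner≈0 last) ⟩
    y ^ p + (0# + x ^ p)                                         ≈⟨ +-congˡ (+-identityˡ _) ⟩
    y ^ p + x ^ p                                                ≈⟨ +-comm _ _ ⟩
    x ^ p + y ^ p                                                ∎
    where
    term : Fin (suc p) → Carrier
    term i = (p C toℕ i) × (x ^ toℕ i * y ^ (p ℕ.∸ toℕ i))

    inner : Fin (suc m) → Carrier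
    inner i = term (Fin.suc (inject₁ i))

    first : term Fin.zero ≈ y ^ p
    first = trans (+-identityʳ _) (*-identityˡ _)

    inner≈0 : sum inner ≈ 0#
    inner≈0 = trans (sum-cong-≋ inner-term≈0) (sum-replicate-zero (suc m))
      where
      inject₁<1+m : ∀ (i : Fin (suc m)) → toℕ (inject₁ i) < suc m
      inject₁<1+m i = ≡.subst (_< suc m) (≡.sym (Fin.toℕ-inject₁ i)) (Fin.toℕ<n i)

      inner-term≈0 : ∀ i → inner i ≈ 0#
      inner-term≈0 i = HasChar-∣⇒×≈0 char (prime∣C p-prime _ (s≤s z≤n) (s≤s (inject₁<1+m i))) _

    last : term (Fin.suc (fromℕ (suc m))) ≈ x ^ p
    last = begin
      term (Fin.suc (fromℕ (suc m))) ≡⟨ ≡.cong (λ t → (p C t) × (x ^ t * y ^ (p ℕ.∸ t))) (≡.cong suc (Fin.toℕ-fromℕ (suc m))) ⟩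
      (p C p) × (x ^ p * y ^ (p ℕ.∸ p)) ≡⟨ ≡.cong₂ (λ n e → n × (x ^ p * y ^ e)) (nCn≡1 p) (ℕ.n∸n≡0 p) ⟩
      1 × (x ^ p * 1#)                 ≈⟨ trans (+-identityʳ _) (*-identityʳ _) ⟩
      x ^ p                            ∎

  frobenius-^ : ∀ {p} → Prime p → HasChar K p → ∀ n x y → (x + y) ^ (p ℕ.^ n) ≈ x ^ (p ℕ.^ n) + y ^ (p ℕ.^ n)
  frobenius-^             p-prime char zero    x y = distribʳ 1# x y
  frobenius-^ {p} p-prime char (suc n) x y = begin
    (x + y) ^ (p ℕ.* p ℕ.^ n)                   ≈⟨ ^-assocʳ (x + y) p (p ℕ.^ n) ⟨
    ((x + y) ^ p) ^ (p ℕ.^ n)                   ≈⟨ ^-congˡ (p ℕ.^ n) (frobenius p-prime char x y) ⟩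
    (x ^ p + y ^ p) ^ (p ℕ.^ n)                 ≈⟨ frobenius-^ p-prime char n (x ^ p) (y ^ p) ⟩
    (x ^ p) ^ (p ℕ.^ n) + (y ^ p) ^ (p ℕ.^ n)   ≈⟨ +-cong (^-assocʳ x p (p ℕ.^ n)) (^-assocʳ y p (p ℕ.^ n)) ⟩
    x ^ (p ℕ.* p ℕ.^ n) + y ^ (p ℕ.* p ℕ.^ n)   ∎

  NontrivialCubeRoot : Carrier → Set ℓ
  NontrivialCubeRoot a = a * a + a + 1# ≈ 0#

  NontrivialCubeRoot-inverse : ∀ {a b} → NontrivialCubeRoot a → a * b ≈ 1# → NontrivialCubeRoot b
  NontrivialCubeRoot-inverse {a} {b} ω ab≈1 =
    trans (certificate a b)
      (zero-sum (zero-sum (zero-multiple _ ω) (zero-multiple _ ab-1≈0)) (zero-multiple _ ab-1≈0))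
    where
    ab-1≈0 : a * b - 1# ≈ 0#
    ab-1≈0 = x≈y⇒x∙y⁻¹≈ε ab≈1

    certificate : ∀ a b → b * b + b + 1# ≈
      (b * b) * (a * a + a + 1#) + (- (a * b + 1#)) * (a * b - 1#) + (- b) * (a * b - 1#)
    certificate = solve 2 (λ a b → b :* b :+ b :+ con (+ 1) :=
      (b :* b) :* (a :* a :+ a :+ con (+ 1)) :+ (:- (a :* b :+ con (+ 1))) :* (a :* b :- con (+ 1))
        :+ (:- b) :* (a :* b :- con (+ 1))) refl

  NontrivialCubeRoot⇒a⁴≈a : ∀ {a} → NontrivialCubeRoot a → (a * a) * (a * a) ≈ a
  NontrivialCubeRoot⇒a⁴≈a {a} ω = x∙y⁻¹≈ε⇒x≈y _ _ (trans (certificate a) (zero-multiple _ ω))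
    where
    certificate : ∀ a → (a * a) * (a * a) - a ≈ (a * a - a) * (a * a + a + 1#)
    certificate = solve 1 (λ a → (a :* a) :* (a :* a) :- a := (a :* a :- a) :* (a :* a :+ a :+ con (+ 1))) refl

  NontrivialCubeRoot⇒[x-a][x-a²]≈0 : ∀ {a x} → NontrivialCubeRoot a → NontrivialCubeRoot x →
                                     (x - a) * (x - a * a) ≈ 0#
  NontrivialCubeRoot⇒[x-a][x-a²]≈0 {a} {x} ωa ωx = trans (certificate a x) (zero-sum ωx (zero-multiple _ ωa))
    where
    certificate : ∀ a x → (x - a) * (x - a * a) ≈ (x * x + x + 1#) + (a - 1# - x) * (a * a + a + 1#)
    certificate = solve 2 (λ a x → (x :- a) :* (x :- a :* a) :=
      (x :* x :+ x :+ con (+ 1)) :+ (a :- con (+ 1) :- x) :* (a :* a :+ a :+ con (+ 1))) refl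

  NontrivialCubeRoot∧a≈a²⇒3≈0 : ∀ {a} → NontrivialCubeRoot a → a - a * a ≈ 0# → 1# + 1# + 1# ≈ 0#
  NontrivialCubeRoot∧a≈a²⇒3≈0 {a} ω a-a²≈0 =
    trans (certificate a) (zero-sum (zero-multiple _ a-a²≈0) (zero-multiple _ ω))
    where
    certificate : ∀ a → 1# + 1# + 1# ≈
      (- (a + 1#) * (1# + 1# + a)) * (a - a * a) + ((1# + 1# + 1# + 1#) - (a * a + a + 1#)) * (a * a + a + 1#)
    certificate = solve 1 (λ a → con (+ 3) :=
      (:- (a :+ con (+ 1)) :* (con (+ 2) :+ a)) :* (a :- a :* a)
        :+ (con (+ 4) :- (a :* a :+ a :+ con (+ 1))) :* (a :* a :+ a :+ con (+ 1))) refl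

  -- For the elementary symmetric functions eᵢ of A, B, C the hypotheses say e₃ = 1, e₁ + e₂ = -3 and
  -- a e₁ + a² e₂ = -3; solving (after multiplying by a - a²) gives e₁ = 3a and e₂ = 3a², so
  -- (X - A)(X - B)(X - C) = (X - a)³.
  NontrivialCubeRoot∧norms⇒[A-a]³≈0 :
    ∀ {a A B C} → NontrivialCubeRoot a → A * B * C ≈ 1# →
    (A + 1#) * (B + 1#) * (C + 1#) ≈ - 1# → (a * A + 1#) * (a * B + 1#) * (a * C + 1#) ≈ - 1# →
    (a - a * a) * ((A - a) * (A - a) * (A - a)) ≈ 0#
  NontrivialCubeRoot∧norms⇒[A-a]³≈0 {a} {A} {B} {C} ω N≈1 N₊≈-1 Nₐ₊≈-1 =
    trans (certificate a A B C)
      (zero-sum (zero-sum (zero-sum (zero-multiple _ ω) (zero-multiple _ (x≈y⇒x∙y⁻¹≈ε N≈1)))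
                          (zero-multiple _ (x≈y⇒x∙y⁻¹≈ε N₊≈-1)))
                (zero-multiple _ (x≈y⇒x∙y⁻¹≈ε Nₐ₊≈-1)))
    where
    certificate : ∀ a A B C →
      (a - a * a) * ((A - a) * (A - a) * (A - a)) ≈
          ((a - 1#) * ((1# + 1# + 1#) - A * B * C) * (A * A + A) + (1# + 1# + 1#) * (a - a * a) * A
            - (a - a * a) * (a - 1#)) * (a * a + a + 1#)
        + ((a * a - 1#) * (A * A + A) + (a - a * a) * A + (a - a * a)) * (A * B * C - 1#)
        + (- (a * a) * (A * A + A) - (a - a * a) * A) * ((A + 1#) * (B + 1#) * (C + 1#) - - 1#)
        + (A * A + A) * ((a * A + 1#) * (a * B + 1#) * (a * C + 1#) - - 1#)
    certificate = solve 4 (λ a A B C →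
      (a :- a :* a) :* ((A :- a) :* (A :- a) :* (A :- a)) :=
          ((a :- con (+ 1)) :* (con (+ 3) :- A :* B :* C) :* (A :* A :+ A) :+ con (+ 3) :* (a :- a :* a) :* A
            :- (a :- a :* a) :* (a :- con (+ 1))) :* (a :* a :+ a :+ con (+ 1))
        :+ ((a :* a :- con (+ 1)) :* (A :* A :+ A) :+ (a :- a :* a) :* A :+ (a :- a :* a)) :* (A :* B :* C :- con (+ 1))
        :+ (:- (a :* a) :* (A :* A :+ A) :- (a :- a :* a) :* A) :* ((A :+ con (+ 1)) :* (B :+ con (+ 1)) :* (C :+ con (+ 1)) :- :- con (+ 1))
        :+ (A :* A :+ A) :* ((a :* A :+ con (+ 1)) :* (a :* B :+ con (+ 1)) :* (a :* C :+ con (+ 1)) :- :- con (+ 1))) refl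

  module _ (K-field : IsField K) where

    x≉0∧xy≈0⇒y≈0 : ∀ {x y} → ¬ x ≈ 0# → x * y ≈ 0# → y ≈ 0#
    x≉0∧xy≈0⇒y≈0 {x} {y} x≉0 xy≈0 with proj₂ K-field x x≉0
    ... | x⁻¹ , xx⁻¹≈1 = begin
      y              ≈⟨ *-identityˡ y ⟨
      1# * y         ≈⟨ *-congʳ (trans (*-comm x⁻¹ x) xx⁻¹≈1) ⟨
      (x⁻¹ * x) * y  ≈⟨ *-assoc x⁻¹ x y ⟩
      x⁻¹ * (x * y)  ≈⟨ zero-multiple x⁻¹ xy≈0 ⟩
      0#             ∎

    x≉0⇒x³≉0 : ∀ {x} → ¬ x ≈ 0# → ¬ x * x * x ≈ 0#
    x≉0⇒x³≉0 {x} x≉0 x³≈0 =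
      x≉0 (x≉0∧xy≈0⇒y≈0 x≉0 (x≉0∧xy≈0⇒y≈0 x≉0 (trans (*-comm x (x * x)) x³≈0)))

    three≉0 : ∀ {p} → Prime p → p ≢ 3 → HasChar K p → ¬ 1# + 1# + 1# ≈ 0#
    three≉0 p-prime p≢3 char 3≈0 =
      proj₁ K-field (coprime-HasChar⇒1≈0 (primes-coprime p-prime (toWitness {a? = prime? 3} _) p≢3) char char-3)
      where
      char-3 : HasChar K 3
      char-3 = trans (+-congˡ (+-congˡ (+-identityʳ 1#))) (trans (sym (+-assoc 1# 1# 1#)) 3≈0)

    module OverFq {p} (p-prime : Prime p) (p≢3 : p ≢ 3) (char : HasChar K p) (k : ℕ) where
      q : ℕ
      q = p ℕ.^ k

      instance
        p≢0 : NonZero p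
        p≢0 = prime⇒nonZero p-prime

        q≢0 : NonZero q
        q≢0 = ℕ.m^n≢0 p k

      frobenius-+1 : ∀ n x → (x + 1#) ^ (p ℕ.^ n) ≈ x ^ (p ℕ.^ n) + 1#
      frobenius-+1 n x = trans (frobenius-^ p-prime char n x 1#) (+-congˡ (1^n≈1 (p ℕ.^ n)))

      Norm≈ : ∀ X → Norm K q X ≈ X * X ^ q * X ^ (q ℕ.* q)
      Norm≈ X = trans (pow≈^ X (suc q ℕ.+ q ℕ.* q)) (^-homo-* X (suc q) (q ℕ.* q))

      Norm-+1≈ : ∀ X → Norm K q (X + 1#) ≈ (X + 1#) * (X ^ q + 1#) * (X ^ (q ℕ.* q) + 1#)
      Norm-+1≈ X = trans (Norm≈ (X + 1#)) (*-cong (*-congˡ (frobenius-+1 k X)) X+1^qq)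
        where
        X+1^qq : (X + 1#) ^ (q ℕ.* q) ≈ X ^ (q ℕ.* q) + 1#
        X+1^qq = ≡.subst (λ n → (X + 1#) ^ n ≈ X ^ n + 1#) (ℕ.^-distribˡ-+-* p k k) (frobenius-+1 (k ℕ.+ k) X)

      NontrivialCubeRoot-^q : ∀ {a} → NontrivialCubeRoot a → NontrivialCubeRoot (a ^ q)
      NontrivialCubeRoot-^q {a} ω = begin
        a ^ q * a ^ q + a ^ q + 1#     ≈⟨ +-congʳ (+-congʳ (^-distrib-* a a q)) ⟨
        (a * a) ^ q + a ^ q + 1#       ≈⟨ +-congʳ (frobenius-^ p-prime char k (a * a) a) ⟨
        (a * a + a) ^ q + 1#           ≈⟨ frobenius-+1 k (a * a + a) ⟨
        (a * a + a + 1#) ^ q           ≈⟨ ^-congˡ q ω ⟩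
        0# ^ q                         ≈⟨ 0^n≈0 q ⟩
        0#                             ∎

      a-a²≉0 : ∀ {a} → NontrivialCubeRoot a → ¬ a - a * a ≈ 0#
      a-a²≉0 ω = three≉0 p-prime p≢3 char ∘ NontrivialCubeRoot∧a≈a²⇒3≈0 ω

      a^q≈a⇒aA∉S4 : ∀ {a A} → NontrivialCubeRoot a → a ^ q ≈ a → S4 K q A → ¬ InF K q A → ¬ S4 K q (a * A)
      a^q≈a⇒aA∉S4 {a} {A} ω a^q≈a (_ , N≈1 , N₊≈-1) A∉Fq (_ , _ , Nₐ₊≈-1) =
        x≉0⇒x³≉0 A-a≉0 (x≉0∧xy≈0⇒y≈0 (a-a²≉0 ω) (NontrivialCubeRoot∧norms⇒[A-a]³≈0 ω
          (trans (sym (Norm≈ A)) N≈1) (trans (sym (Norm-+1≈ A)) N₊≈-1) (trans (sym Nₐ₊≈) Nₐ₊≈-1)))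
        where
        aA^n : ∀ n → a ^ n ≈ a → (a * A) ^ n ≈ a * A ^ n
        aA^n n aⁿ≈a = trans (^-distrib-* a A n) (*-congʳ aⁿ≈a)

        Nₐ₊≈ : Norm K q (a * A + 1#) ≈ (a * A + 1#) * (a * A ^ q + 1#) * (a * A ^ (q ℕ.* q) + 1#)
        Nₐ₊≈ = trans (Norm-+1≈ (a * A)) (*-cong (*-congˡ (+-congʳ (aA^n q a^q≈a)))
                                               (+-congʳ (aA^n (q ℕ.* q) (^-compose q q a^q≈a a^q≈a))))

        A-a≉0 : ¬ A - a ≈ 0#
        A-a≉0 A-a≈0 = A∉Fq (begin
          pow K A q  ≈⟨ pow≈^ A q ⟩
          A ^ q      ≈⟨ ^-congˡ q A≈a ⟩
          a ^ q      ≈⟨ a^q≈a ⟩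
          a          ≈⟨ A≈a ⟨
          A          ∎)
          where
          A≈a : A ≈ a
          A≈a = x∙y⁻¹≈ε⇒x≈y A a A-a≈0

      a^q≈a²⇒aA∉S4 : ∀ {a A} → NontrivialCubeRoot a → a ^ q ≈ a * a → S4 K q A → ¬ S4 K q (a * A)
      a^q≈a²⇒aA∉S4 {a} {A} ω a^q≈a² (A∈Fq³ , N≈1 , _) (aA∈Fq³ , _ , _) =
        a-a²≉0 ω (x≉0∧xy≈0⇒y≈0 A≉0 (trans (A[a-a²]≈aA-a²A a A) (x≈y⇒x∙y⁻¹≈ε (sym a²A≈aA))))
        where
        a^qq≈a : a ^ (q ℕ.* q) ≈ a
        a^qq≈a = ^-compose q q a^q≈a² (trans (^-distrib-* a a q) (trans (*-cong a^q≈a² a^q≈a²) (NontrivialCubeRoot⇒a⁴≈a ω)))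

        a²A≈aA : a * a * A ≈ a * A
        a²A≈aA = begin
          a * a * A                              ≈⟨ *-cong (^-compose (q ℕ.* q) q a^qq≈a a^q≈a²) A∈Fq³′ ⟨
          a ^ (q ℕ.* q ℕ.* q) * A ^ (q ℕ.* q ℕ.* q) ≈⟨ ^-distrib-* a A (q ℕ.* q ℕ.* q) ⟨
          (a * A) ^ (q ℕ.* q ℕ.* q)              ≈⟨ pow≈^ (a * A) (q ℕ.* q ℕ.* q) ⟨
          pow K (a * A) (q ℕ.* q ℕ.* q)          ≈⟨ aA∈Fq³ ⟩
          a * A                                  ∎
          where
          A∈Fq³′ : A ^ (q ℕ.* q ℕ.* q) ≈ A
          A∈Fq³′ = trans (sym (pow≈^ A (q ℕ.* q ℕ.* q))) A∈Fq³

        A≉0 : ¬ A ≈ 0#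
        A≉0 A≈0 = proj₁ K-field (begin
          1#                              ≈⟨ N≈1 ⟨
          Norm K q A                      ≈⟨ Norm≈ A ⟩
          A * A ^ q * A ^ (q ℕ.* q)       ≈⟨ *-congʳ (*-congʳ A≈0) ⟩
          0# * A ^ q * A ^ (q ℕ.* q)      ≈⟨ trans (*-congʳ (zeroˡ _)) (zeroˡ _) ⟩
          0#                              ∎)

        A[a-a²]≈aA-a²A : ∀ a A → A * (a - a * a) ≈ a * A - a * a * A
        A[a-a²]≈aA-a²A = solve 2 (λ a A → A :* (a :- a :* a) := a :* A :- a :* a :* A) refl

      aA∉S4 : ∀ {a A} → NontrivialCubeRoot a → S4 K q A → ¬ InF K q A → ¬ S4 K q (a * A)
      -- Equality in K is not decidable, so a^q ∈ {a, a²} is used as: a^q ≉ a ⇒ a^q ≈ a².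
      aA∉S4 {a} ω A∈S A∉Fq aA∈S =
        a^q≈a²⇒aA∉S4 ω (x∙y⁻¹≈ε⇒x≈y _ _ (x≉0∧xy≈0⇒y≈0 a^q-a≉0 conjugates)) A∈S aA∈S
        where
        conjugates : (a ^ q - a) * (a ^ q - a * a) ≈ 0#
        conjugates = NontrivialCubeRoot⇒[x-a][x-a²]≈0 ω (NontrivialCubeRoot-^q ω)

        a^q-a≉0 : ¬ a ^ q - a ≈ 0#
        a^q-a≉0 a^q-a≈0 = a^q≈a⇒aA∉S4 ω (x∙y⁻¹≈ε⇒x≈y _ _ a^q-a≈0) A∈S A∉Fq aA∈S

open import Data.Nat using (_^_; _≥_)
open import Data.Product using (_×_)

mainTheorem12 : ∀ {c ℓ : Level} (K : CommutativeRing c ℓ) →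
  IsField K → AlgClosed K →
  ∀ (p k : ℕ) → Prime p → p ≢ 3 → k ≥ 1 → HasChar K p →
  let open CommutativeRing K
      q = p ^ k
  in ∀ (a A : Carrier) → a * a + a + 1# ≈ 0# →
     S4 K q A → ¬ InF K q A →
     ¬ S4 K q (a * A) × (∀ b → a * b ≈ 1# → ¬ S4 K q (b * A))
mainTheorem12 K K-field _ p k p-prime p≢3 _ char a A ω A∈S A∉Fq =
  aA∉S4 ω A∈S A∉Fq , λ b ab≈1 → aA∉S4 (NontrivialCubeRoot-inverse K ω ab≈1) A∈S A∉Fq
  where open OverFq K K-field p-prime p≢3 char k
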